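{- If $G=(X,Y;E)$ is a bipartite graph with $\Delta(G)=6$ in which every vertex of $X$ has degree in $\{1,2,4,5,6\}$, then $\chi'_{int}(G,X)\leq 10$.
   Context: For a bipartite graph $G$ with parts $X$ and $Y$, an $X$-interval coloring is a proper edge coloring of $G$ by integers such that, for every vertex $x\in X$, the set of colors on the edges incident to $x$ forms an interval of consecutive integers; $\chi'_{int}(G,X)$ is the smallest number of colors in an $X$-interval coloring of $G$. $\Delta(G)$ is the maximum degree of $G$. Graphs have no multiple edges. -}

module Defs where

open import Data.Nat using (ℕ; _≤_; _<_)
open import Data.Bool using (Bool; true; false; if_then_else_)
open import Data.Fin using (Fin)
open import Data.List using (List; map; allFin)
open import Data.Nat.ListAction using (sum)
open import Data.Product using (Σ; _×_; ∃)
open import Data.Sum using (_⊎_)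
open import Relation.Binary.PropositionalEquality using (_≡_; _≢_)

-- A (simple) bipartite graph G = (X,Y;E) with X = Fin m, Y = Fin n.
-- Edges are given by an adjacency predicate, so there are no multiple edges.
record BipGraph : Set where
  field
    m : ℕ
    n : ℕ
    adj : Fin m → Fin n → Bool

open BipGraph public

Edge : (G : BipGraph) → Fin (m G) → Fin (n G) → Set
Edge G x y = adj G x y ≡ true

degX : (G : BipGraph) → Fin (m G) → ℕ
degX G x = sum (map (λ y → if adj G x y then 1 else 0) (allFin (n G)))

degY : (G : BipGraph) → Fin (n G) → ℕ
degY G y = sum (map (λ x → if adj G x y then 1 else 0) (allFin (m G)))

MaxDegree : BipGraph → ℕ → Set
MaxDegree G d =
  ((x : Fin (m G)) → degX G x ≤ d) ×
  ((y : Fin (n G)) → degY G y ≤ d) ×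
  ((Σ (Fin (m G)) λ x → degX G x ≡ d) ⊎ (Σ (Fin (n G)) λ y → degY G y ≡ d))

-- an edge colouring by integers (non-negative w.l.o.g.; values on non-edges are irrelevant)
Colouring : BipGraph → Set
Colouring G = Fin (m G) → Fin (n G) → ℕ

Proper : (G : BipGraph) → Colouring G → Set
Proper G c =
  ((x : Fin (m G)) (y y' : Fin (n G)) → Edge G x y → Edge G x y' → y ≢ y' → c x y ≢ c x y') ×
  ((y : Fin (n G)) (x x' : Fin (m G)) → Edge G x y → Edge G x' y → x ≢ x' → c x y ≢ c x' y)

XInterval : (G : BipGraph) → Colouring G → Set
XInterval G c =
  (x : Fin (m G)) (y y' : Fin (n G)) (k : ℕ) →
  Edge G x y → Edge G x y' → c x y ≤ k → k ≤ c x y' →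
  Σ (Fin (n G)) λ y'' → Edge G x y'' × c x y'' ≡ k

IsXIntervalColouring : (G : BipGraph) → Colouring G → Set
IsXIntervalColouring G c = Proper G c × XInterval G c

χint≤ : BipGraph → ℕ → Set
χint≤ G t = Σ (Colouring G) λ c →
  IsXIntervalColouring G c × ((x : Fin (m G)) (y : Fin (n G)) → Edge G x y → c x y < t)

DegOK : ℕ → Set
DegOK d = d ≡ 1 ⊎ d ≡ 2 ⊎ d ≡ 4 ⊎ d ≡ 5 ⊎ d ≡ 6

-- Split every vertex into pairs of consecutive incident edges. The graph of pairs has maximum degree 2,
-- so by König's theorem the edges get parities 0 / 1, different within each pair. At a vertex the edges
-- of one parity then lie in distinct pairs, at most three of them; a second use of König's theorem, on a
-- bipartite graph of maximum degree 3 built from the two parity classes (with a "link" for each empty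
-- pair at a vertex of X), gives every edge one of three blocks, distinct among the edges of equal parity
-- at a vertex. The colours 0, …, 9 form five blocks {2i, 2i + 1}; at each x ∈ X the three blocks are
-- placed on a window of three consecutive ones. For degrees 1, 2, 4, 5, 6 the set of (block, parity)
-- pairs present at x is so constrained that some window makes its colours consecutive (for degree 3
-- this can fail).
module Submission where

open import Defs
open import Data.Nat
  using (ℕ; zero; suc; _+_; _*_; _∸_; _≤_; _<_; _≤?_; _<ᵇ_; _≟_; z≤n; s≤s; _/_; _%_; NonZero)
open import Data.Nat.Properties
  using (≤-refl; <-irrefl; ≤-trans; ≤-pred; ≮⇒≥; _<?_; m≤n⇒m<n∨m≡n; <-≤-trans; ≤-<-trans; <⇒≢;
         +-monoʳ-≤; +-monoʳ-<; +-cancelˡ-≡; +-identityʳ; m∸n≤m; n<1⇒n≡0; allUpTo?; anyUpTo?)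
open import Data.Nat.DivMod
  using (m≡m%n+[m/n]*n; m%n<n; m/n*n≤m; m<n*o⇒m/o<n; +-distrib-/-∣ˡ; m*n/n≡m; m<n⇒m/n≡0; m<n⇒m%n≡m;
         [m+n]%n≡m%n)
open import Data.Nat.Divisibility using (n∣m*n)
open import Data.Nat.ListAction using (sum)
open import Data.Bool using (Bool; true; false; if_then_else_)
import Data.Bool as Bool
open import Data.Fin using (Fin; toℕ; fromℕ<) renaming (zero to fzero; suc to fsuc)
open import Data.Fin.Properties using (pigeonhole; toℕ-fromℕ<; toℕ-injective; toℕ<n; all?; ¬∀⟶∃¬)
import Data.Fin.Properties as Fin
open import Data.List
  using (List; []; _∷_; length; lookup; map; filter; cartesianProduct; allFin; upTo; _++_)
open import Data.List.Properties using (map-tabulate)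
open import Data.List.Membership.Propositional using (_∈_; _∉_; find; lose)
open import Data.List.Membership.Propositional.Properties
  using (∈-filter⁺; ∈-filter⁻; ∈-cartesianProduct⁺; ∈-cartesianProduct⁻; ∈-allFin; ∈-upTo⁺;
         ∈-upTo⁻; ∈-map⁺; ∈-map⁻; ∈-++⁺ˡ; ∈-++⁺ʳ; ∈-++⁻)
import Data.List.Membership.DecPropositional as DecMembership
open import Data.List.Relation.Unary.Any using (Any; here; there; any?; index)
open import Data.List.Relation.Unary.Any.Properties using (lookup-index)
open import Data.Maybe using (Maybe; just; nothing; _>>=_)
import Data.Maybe.Properties as Maybe
open import Data.Product using (∃; _×_; _,_; proj₁; proj₂)
import Data.Product.Properties as Product
open import Data.Sum using (_⊎_; inj₁; inj₂; [_,_]′)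
import Data.Sum.Properties as Sum
open import Data.Empty using (⊥; ⊥-elim)
open import Data.Unit using (⊤; tt)
open import Function using (_∘_; case_of_)
open import Function.Bundles using (_⇔_; mk⇔; Equivalence)
open import Function.Definitions using (Injective)
open import Relation.Nullary using (Dec; yes; no; ¬_; ¬?; _×-dec_; _⊎-dec_; _→-dec_; contradiction)
open import Relation.Nullary.Decidable using (toWitness; toSum; True)
open import Relation.Binary.Definitions using (DecidableEquality; tri<; tri≈; tri>)
open import Relation.Binary.PropositionalEquality
  using (_≡_; _≢_; refl; sym; trans; cong; cong₂; subst; module ≡-Reasoning)

module Konig {A V : Set} (_≟A_ : DecidableEquality A) (_≟V_ : DecidableEquality V)
             (l r : A → V) (k : ℕ) where

  open DecMembership _≟A_ using (_∈?_)

  ProperAt : (A → V) → (A → ℕ) → List A → Set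
  ProperAt v c es = ∀ {e f} → e ∈ es → f ∈ es → e ≢ f → v e ≡ v f → c e ≢ c f

  ProperOn : (A → ℕ) → List A → Set
  ProperOn c es = ProperAt l c es × ProperAt r c es

  Bounded : (A → ℕ) → List A → Set
  Bounded c es = ∀ {e} → e ∈ es → c e < k

  ColouredAt : (A → V) → (A → ℕ) → V → ℕ → A → Set
  ColouredAt v c z γ f = v f ≡ z × c f ≡ γ

  colouredAt? : ∀ v c z γ f → Dec (ColouredAt v c z γ f)
  colouredAt? v c z γ f = (v f ≟V z) ×-dec (c f ≟ γ)

  Free : (A → V) → (A → ℕ) → List A → A → ℕ → Set
  Free v c es e α = ∀ {f} → f ∈ es → v f ≡ v e → c f ≢ α

  ProperAt-unique : ∀ {v c es e f} → ProperAt v c es → e ∈ es → f ∈ es →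
                    v e ≡ v f → c e ≡ c f → e ≡ f
  ProperAt-unique {e = e} {f} proper e∈ f∈ ve≡vf ce≡cf with e ≟A f
  ... | yes e≡f = e≡f
  ... | no e≢f = contradiction ce≡cf (proper e∈ f∈ e≢f ve≡vf)

  ProperAt-tail : ∀ {v c e es} → ProperAt v c (e ∷ es) → ProperAt v c es
  ProperAt-tail proper e∈ f∈ = proper (there e∈) (there f∈)

  Bounded-tail : ∀ {c e es} → Bounded c (e ∷ es) → Bounded c es
  Bounded-tail bounded e∈ = bounded (there e∈)

  incident-not-injective : ∀ {v lab es z} → Bounded lab es → ProperAt v lab es →
                           (g : Fin (suc k) → A) → (∀ i → g i ∈ es) → (∀ i → v (g i) ≡ z) →
                           ¬ Injective _≡_ _≡_ g
  incident-not-injective {lab = lab} bounded proper g g∈ vg≡z g-inj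
    with pigeonhole (s≤s ≤-refl) (λ i → fromℕ< (bounded (g∈ i)))
  ... | i , j , i<j , labels≡ =
    <-irrefl (cong toℕ i≡j) i<j
    where
      lab≡ : lab (g i) ≡ lab (g j)
      lab≡ = trans (sym (toℕ-fromℕ< _)) (trans (cong toℕ labels≡) (toℕ-fromℕ< _))
      i≡j : i ≡ j
      i≡j = g-inj (ProperAt-unique proper (g∈ i) (g∈ j) (trans (vg≡z i) (sym (vg≡z j))) lab≡)

  free-colour : ∀ {v lab} c {e es} → Bounded lab (e ∷ es) → ProperAt v lab (e ∷ es) → e ∉ es →
                ∃ λ α → α < k × Free v c es e α
  free-colour {v} {lab} c {e} {es} bounded proper e∉ with all? (λ α → any? (colouredAt? v c (v e) (toℕ α)) es)
  ... | no ¬all =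
    let α , unused = ¬∀⟶∃¬ k _ (λ α → any? (colouredAt? v c (v e) (toℕ α)) es) ¬all
    in toℕ α , toℕ<n α , λ f∈ vf≡ve cf≡α → unused (lose f∈ (vf≡ve , cf≡α))
  ... | yes all = ⊥-elim (incident-not-injective bounded proper g g∈ vg g-inj)
    where
      g : Fin (suc k) → A
      g fzero = e
      g (fsuc α) = proj₁ (find (all α))
      g∈ : ∀ i → g i ∈ e ∷ es
      g∈ fzero = here refl
      g∈ (fsuc α) = there (proj₁ (proj₂ (find (all α))))
      vg : ∀ i → v (g i) ≡ v e
      vg fzero = refl
      vg (fsuc α) = proj₁ (proj₂ (proj₂ (find (all α))))
      cg : ∀ α → c (g (fsuc α)) ≡ toℕ α
      cg α = proj₂ (proj₂ (proj₂ (find (all α))))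
      g-inj : Injective _≡_ _≡_ g
      g-inj {fzero} {fzero} _ = refl
      g-inj {fzero} {fsuc β} e≡ = contradiction (subst (_∈ es) (sym e≡) (proj₁ (proj₂ (find (all β))))) e∉
      g-inj {fsuc α} {fzero} ≡e = contradiction (subst (_∈ es) ≡e (proj₁ (proj₂ (find (all α))))) e∉
      g-inj {fsuc α} {fsuc β} g≡ = cong fsuc (toℕ-injective (trans (sym (cg α)) (trans (cong c g≡) (cg β))))

  ∈-not-injective : ∀ xs (g : Fin (suc (length xs)) → A) → (∀ i → g i ∈ xs) → ¬ Injective _≡_ _≡_ g
  ∈-not-injective xs g g∈ g-inj with pigeonhole (s≤s ≤-refl) (λ i → index (g∈ i))
  ... | i , j , i<j , index≡ = <-irrefl (cong toℕ (g-inj g≡)) i<j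
    where
      g≡ : g i ≡ g j
      g≡ = trans (lookup-index (g∈ i)) (trans (cong (lookup xs) index≡) (sym (lookup-index (g∈ j))))

  chosen : ∀ {P : A → Set} {xs} → Dec (Any P xs) → Maybe A
  chosen (yes p) = just (proj₁ (find p))
  chosen (no _) = nothing

  chosen-sound : ∀ {P : A → Set} {xs f} (d : Dec (Any P xs)) → chosen d ≡ just f → f ∈ xs × P f
  chosen-sound (yes p) refl = proj₂ (find p)

  chosen-complete : ∀ {P : A → Set} {xs f} (d : Dec (Any P xs)) → f ∈ xs → P f →
                    ∃ λ g → chosen d ≡ just g
  chosen-complete (yes p) _ _ = proj₁ (find p) , refl
  chosen-complete (no ¬p) f∈ pf = contradiction (lose f∈ pf) ¬p

  -- Kempe chain: exchanging α and β along the alternating path that starts with the α-edge at the r-end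
  -- of e makes α free at both ends of e; the path cannot reach the l-end of e, where α is free.
  module KempeChain (c : A → ℕ) {D : List A} (proper : ProperOn c D) (e : A) {α β : ℕ}
                    (α≢β : α ≢ β) (α-free : Free l c D e α) (β-free : Free r c D e β) where

    edgeAt : (A → V) → V → ℕ → Maybe A
    edgeAt v z γ = chosen (any? (colouredAt? v c z γ) D)

    edgeAt-sound : ∀ {v z γ f} → edgeAt v z γ ≡ just f → f ∈ D × ColouredAt v c z γ f
    edgeAt-sound {v} {z} {γ} = chosen-sound (any? (colouredAt? v c z γ) D)

    edgeAt-complete : ∀ {v z γ f} → ProperAt v c D → f ∈ D → ColouredAt v c z γ f →
                      edgeAt v z γ ≡ just f
    edgeAt-complete {v} {z} {γ} properAt f∈ (vf≡z , cf≡γ)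
      with chosen-complete (any? (colouredAt? v c z γ) D) f∈ (vf≡z , cf≡γ)
    ... | g , found with edgeAt-sound found
    ... | g∈ , vg≡z , cg≡γ =
      trans found (cong just (ProperAt-unique properAt g∈ f∈ (trans vg≡z (sym vf≡z))
                                                             (trans cg≡γ (sym cf≡γ))))

    Step : A → A → Set
    Step f g = (c f ≡ α × c g ≡ β × l f ≡ l g) ⊎ (c f ≡ β × c g ≡ α × r f ≡ r g)

    next : A → Maybe A
    next f with c f ≟ α
    ... | yes _ = edgeAt l (l f) β
    ... | no _ = edgeAt r (r f) α

    next-sound : ∀ {f g} → c f ≡ α ⊎ c f ≡ β → next f ≡ just g → g ∈ D × Step f g
    next-sound {f} cf∈ found with c f ≟ α | cf∈
    ... | yes cf≡α | _ =
      let g∈ , lg≡lf , cg≡β = edgeAt-sound found in g∈ , inj₁ (cf≡α , cg≡β , sym lg≡lf)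
    ... | no cf≢α | inj₁ cf≡α = contradiction cf≡α cf≢α
    ... | no _ | inj₂ cf≡β =
      let g∈ , rg≡rf , cg≡α = edgeAt-sound found in g∈ , inj₂ (cf≡β , cg≡α , sym rg≡rf)

    next-complete : ∀ {f g} → g ∈ D → Step f g → next f ≡ just g
    next-complete {f} g∈ step with c f ≟ α | step
    ... | yes _ | inj₁ (_ , cg≡β , lf≡lg) = edgeAt-complete (proj₁ proper) g∈ (sym lf≡lg , cg≡β)
    ... | yes cf≡α | inj₂ (cf≡β , _) = contradiction (trans (sym cf≡α) cf≡β) α≢β
    ... | no cf≢α | inj₁ (cf≡α , _) = contradiction cf≡α cf≢α
    ... | no _ | inj₂ (_ , cg≡α , rf≡rg) = edgeAt-complete (proj₂ proper) g∈ (sym rf≡rg , cg≡α)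

    Step-pred-unique : ∀ {f h g} → f ∈ D → h ∈ D → Step f g → Step h g → f ≡ h
    Step-pred-unique f∈ h∈ (inj₁ (cf≡α , _ , lf≡lg)) (inj₁ (ch≡α , _ , lh≡lg)) =
      ProperAt-unique (proj₁ proper) f∈ h∈ (trans lf≡lg (sym lh≡lg)) (trans cf≡α (sym ch≡α))
    Step-pred-unique f∈ h∈ (inj₂ (cf≡β , _ , rf≡rg)) (inj₂ (ch≡β , _ , rh≡rg)) =
      ProperAt-unique (proj₂ proper) f∈ h∈ (trans rf≡rg (sym rh≡rg)) (trans cf≡β (sym ch≡β))
    Step-pred-unique _ _ (inj₁ (_ , cg≡β , _)) (inj₂ (_ , cg≡α , _)) = ⊥-elim (α≢β (trans (sym cg≡α) cg≡β))
    Step-pred-unique _ _ (inj₂ (_ , cg≡α , _)) (inj₁ (_ , cg≡β , _)) = ⊥-elim (α≢β (trans (sym cg≡α) cg≡β))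

    walk : ℕ → Maybe A
    walk zero = edgeAt r (r e) α
    walk (suc i) = walk i >>= next

    walk-suc : ∀ i {g} → walk (suc i) ≡ just g → ∃ λ f → walk i ≡ just f × next f ≡ just g
    walk-suc i found with walk i
    ... | just f = f , refl , found

    walk-edge : ∀ i {f} → walk i ≡ just f → f ∈ D × (c f ≡ α ⊎ c f ≡ β)
    walk-edge zero found = let f∈ , _ , cf≡α = edgeAt-sound found in f∈ , inj₁ cf≡α
    walk-edge (suc i) found with walk-suc i found
    ... | f , walk-f , next-g with next-sound (proj₂ (walk-edge i walk-f)) next-g
    ... | g∈ , inj₁ (_ , cg≡β , _) = g∈ , inj₂ cg≡β
    ... | g∈ , inj₂ (_ , cg≡α , _) = g∈ , inj₁ cg≡α

    walk-pred : ∀ i {g} → walk (suc i) ≡ just g → ∃ λ f → walk i ≡ just f × f ∈ D × Step f g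
    walk-pred i found with walk-suc i found
    ... | f , walk-f , next-g =
      f , walk-f , proj₁ (walk-edge i walk-f) , proj₂ (next-sound (proj₂ (walk-edge i walk-f)) next-g)

    walk-start-no-pred : ∀ {f g} → walk 0 ≡ just g → f ∈ D → ¬ Step f g
    walk-start-no-pred found f∈ (inj₁ (_ , cg≡β , _)) =
      α≢β (trans (sym (proj₂ (proj₂ (edgeAt-sound found)))) cg≡β)
    walk-start-no-pred found f∈ (inj₂ (cf≡β , _ , rf≡rg)) =
      β-free f∈ (trans rf≡rg (proj₁ (proj₂ (edgeAt-sound found)))) cf≡β

    walk-no-repeat : ∀ {i j f} → i < j → walk i ≡ just f → walk j ≡ just f → ⊥
    walk-no-repeat {zero} {suc j} _ walk-i walk-j =
      let _ , _ , h∈ , step = walk-pred j walk-j in walk-start-no-pred walk-i h∈ step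
    walk-no-repeat {suc i} {suc j} (s≤s i<j) walk-i walk-j =
      let h , walk-h , h∈ , step = walk-pred i walk-i
          h' , walk-h' , h'∈ , step' = walk-pred j walk-j
      in walk-no-repeat i<j walk-h (subst (λ z → walk j ≡ just z) (Step-pred-unique h'∈ h∈ step' step) walk-h')

    walk-prefix : ∀ {i j f} → j ≤ i → walk i ≡ just f → ∃ λ g → walk j ≡ just g
    walk-prefix {i} {j} {f} j≤i found with m≤n⇒m<n∨m≡n j≤i
    ... | inj₂ refl = f , found
    walk-prefix {suc i} _ found | inj₁ j<1+i = walk-prefix (≤-pred j<1+i) (proj₁ (proj₂ (walk-suc i found)))

    walk-bound : ∀ i {f} → walk i ≡ just f → i < length D
    walk-bound i found with i <? length D
    ... | yes i<N = i<N
    ... | no i≮N = ⊥-elim (∈-not-injective D g g∈ g-inj)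
      where
        visit : (j : Fin (suc (length D))) → ∃ λ g → walk (toℕ j) ≡ just g
        visit j = walk-prefix (≤-trans (≤-pred (toℕ<n j)) (≮⇒≥ i≮N)) found
        g : Fin (suc (length D)) → A
        g j = proj₁ (visit j)
        g∈ : ∀ j → g j ∈ D
        g∈ j = proj₁ (walk-edge (toℕ j) (proj₂ (visit j)))
        revisit : ∀ {j j'} → g j ≡ g j' → walk (toℕ j') ≡ just (g j)
        revisit {j' = j'} g≡ = subst (λ z → walk (toℕ j') ≡ just z) (sym g≡) (proj₂ (visit j'))
        g-inj : Injective _≡_ _≡_ g
        g-inj {j} {j'} g≡ with Fin.<-cmp j j'
        ... | tri< j<j' _ _ = ⊥-elim (walk-no-repeat j<j' (proj₂ (visit j)) (revisit {j} {j'} g≡))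
        ... | tri≈ _ j≡j' _ = j≡j'
        ... | tri> _ _ j'<j = ⊥-elim (walk-no-repeat j'<j (proj₂ (visit j')) (revisit {j'} {j} (sym g≡)))

    InChain : A → Set
    InChain f = ∃ λ i → walk i ≡ just f

    inChain? : ∀ f → Dec (InChain f)
    inChain? f with anyUpTo? (λ i → Maybe.≡-dec _≟A_ (walk i) (just f)) (length D)
    ... | yes (i , _ , found) = yes (i , found)
    ... | no none = no λ (i , found) → none (i , walk-bound i found , found)

    chain-forward : ∀ {f g} → InChain f → g ∈ D → Step f g → InChain g
    chain-forward (i , walk-f) g∈ step =
      suc i , subst (λ w → (w >>= next) ≡ just _) (sym walk-f) (next-complete g∈ step)

    chain-backward : ∀ {f g} → InChain g → f ∈ D → Step f g → InChain f
    chain-backward (zero , walk-g) f∈ step = ⊥-elim (walk-start-no-pred walk-g f∈ step)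
    chain-backward (suc i , walk-g) f∈ step =
      let h , walk-h , h∈ , step' = walk-pred i walk-g
      in i , subst (λ z → walk i ≡ just z) (Step-pred-unique h∈ f∈ step' step) walk-h

    chain-β-pred : ∀ {f} → InChain f → c f ≡ β → ∃ λ h → h ∈ D × Step h f
    chain-β-pred (zero , walk-f) cf≡β =
      ⊥-elim (α≢β (trans (sym (proj₂ (proj₂ (edgeAt-sound walk-f)))) cf≡β))
    chain-β-pred (suc i , walk-f) _ = let h , _ , h∈ , step = walk-pred i walk-f in h , h∈ , step

    -- Only applied to chain edges, which are coloured α or β.
    swap : ℕ → ℕ
    swap γ with γ ≟ α
    ... | yes _ = β
    ... | no _ = α

    recoloured : A → ℕ
    recoloured f with inChain? f
    ... | yes _ = swap (c f)
    ... | no _ = c f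

    recoloured-out : ∀ {f} → ¬ InChain f → recoloured f ≡ c f
    recoloured-out {f} f∉ with inChain? f
    ... | yes f∈ = contradiction f∈ f∉
    ... | no _ = refl

    recoloured-in : ∀ {f} → InChain f →
                    (c f ≡ α × recoloured f ≡ β) ⊎ (c f ≡ β × recoloured f ≡ α)
    recoloured-in {f} f∈ with inChain? f
    ... | no f∉ = contradiction f∈ f∉
    ... | yes (i , walk-f) with proj₂ (walk-edge i walk-f) | c f ≟ α
    ... | _ | yes cf≡α = inj₁ (cf≡α , refl)
    ... | inj₁ cf≡α | no cf≢α = contradiction cf≡α cf≢α
    ... | inj₂ cf≡β | no _ = inj₂ (cf≡β , refl)

    ChainClosedAt : (A → V) → Set
    ChainClosedAt v = ∀ {f g} → InChain f → g ∈ D → v f ≡ v g → c g ≡ recoloured f → InChain g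

    chain-closed-l : ChainClosedAt l
    chain-closed-l f∈ g∈ lf≡lg cg≡ with recoloured-in f∈
    ... | inj₁ (cf≡α , new≡β) = chain-forward f∈ g∈ (inj₁ (cf≡α , trans cg≡ new≡β , lf≡lg))
    ... | inj₂ (cf≡β , new≡α) = chain-backward f∈ g∈ (inj₁ (trans cg≡ new≡α , cf≡β , sym lf≡lg))

    chain-closed-r : ChainClosedAt r
    chain-closed-r f∈ g∈ rf≡rg cg≡ with recoloured-in f∈
    ... | inj₁ (cf≡α , new≡β) = chain-backward f∈ g∈ (inj₂ (trans cg≡ new≡β , cf≡α , sym rf≡rg))
    ... | inj₂ (cf≡β , new≡α) = chain-forward f∈ g∈ (inj₂ (cf≡β , trans cg≡ new≡α , rf≡rg))

    recoloured-properAt : ∀ {v} → ProperAt v c D → ChainClosedAt v → ProperAt v recoloured D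
    recoloured-properAt {v} properAt closed {f} {g} f∈ g∈ f≢g vf≡vg new≡
      with toSum (inChain? f) | toSum (inChain? g)
    ... | inj₁ f∈C | inj₁ g∈C = both (recoloured-in f∈C) (recoloured-in g∈C)
      where
        both : _ → _ → ⊥
        both (inj₁ (cf≡α , _)) (inj₁ (cg≡α , _)) =
          properAt f∈ g∈ f≢g vf≡vg (trans cf≡α (sym cg≡α))
        both (inj₂ (cf≡β , _)) (inj₂ (cg≡β , _)) =
          properAt f∈ g∈ f≢g vf≡vg (trans cf≡β (sym cg≡β))
        both (inj₁ (_ , nf≡β)) (inj₂ (_ , ng≡α)) = α≢β (trans (sym ng≡α) (trans (sym new≡) nf≡β))
        both (inj₂ (_ , nf≡α)) (inj₁ (_ , ng≡β)) = α≢β (trans (sym nf≡α) (trans new≡ ng≡β))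
    ... | inj₁ f∈C | inj₂ g∉C =
      g∉C (closed f∈C g∈ vf≡vg (trans (sym (recoloured-out g∉C)) (sym new≡)))
    ... | inj₂ f∉C | inj₁ g∈C =
      f∉C (closed g∈C f∈ (sym vf≡vg) (trans (sym (recoloured-out f∉C)) new≡))
    ... | inj₂ f∉C | inj₂ g∉C =
      properAt f∈ g∈ f≢g vf≡vg (trans (sym (recoloured-out f∉C)) (trans new≡ (recoloured-out g∉C)))

    recoloured-proper : ProperOn recoloured D
    recoloured-proper = recoloured-properAt (proj₁ proper) chain-closed-l ,
                        recoloured-properAt (proj₂ proper) chain-closed-r

    recoloured-bounded : Bounded c D → α < k → β < k → Bounded recoloured D
    recoloured-bounded bounded α<k β<k {f} f∈ with toSum (inChain? f)
    ... | inj₂ f∉C = subst (_< k) (sym (recoloured-out f∉C)) (bounded f∈)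
    ... | inj₁ f∈C with recoloured-in f∈C
    ...   | inj₁ (_ , new≡β) = subst (_< k) (sym new≡β) β<k
    ...   | inj₂ (_ , new≡α) = subst (_< k) (sym new≡α) α<k

    α-free-l : Free l recoloured D e α
    α-free-l {f} f∈ lf≡le new≡α with toSum (inChain? f)
    ... | inj₂ f∉C = α-free f∈ lf≡le (trans (sym (recoloured-out f∉C)) new≡α)
    ... | inj₁ f∈C with recoloured-in f∈C
    ...   | inj₁ (_ , new≡β) = α≢β (trans (sym new≡α) new≡β)
    ...   | inj₂ (cf≡β , _) with chain-β-pred f∈C cf≡β
    ...     | h , h∈ , inj₁ (ch≡α , _ , lh≡lf) = α-free h∈ (trans lh≡lf lf≡le) ch≡α
    ...     | h , h∈ , inj₂ (_ , cf≡α , _) = α≢β (trans (sym cf≡α) cf≡β)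

    α-free-r : Free r recoloured D e α
    α-free-r {f} f∈ rf≡re new≡α with toSum (inChain? f)
    ... | inj₂ f∉C =
      f∉C (0 , edgeAt-complete (proj₂ proper) f∈ (rf≡re , trans (sym (recoloured-out f∉C)) new≡α))
    ... | inj₁ f∈C with recoloured-in f∈C
    ...   | inj₁ (_ , new≡β) = α≢β (trans (sym new≡α) new≡β)
    ...   | inj₂ (cf≡β , _) = β-free f∈ rf≡re cf≡β

  extend : ∀ {c es e α} → Bounded c es → ProperOn c es → e ∉ es → α < k →
           Free l c es e α → Free r c es e α → ∃ λ c' → Bounded c' (e ∷ es) × ProperOn c' (e ∷ es)
  extend {c} {es} {e} {α} bounded (properL , properR) e∉ α<k free-l free-r =
    c' , bounded' , properAt' properL free-l , properAt' properR free-r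
    where
      c' : A → ℕ
      c' f with f ≟A e
      ... | yes _ = α
      ... | no _ = c f

      c'-new : c' e ≡ α
      c'-new with e ≟A e
      ... | yes _ = refl
      ... | no e≢e = contradiction refl e≢e

      c'-old : ∀ {f} → f ∈ es → c' f ≡ c f
      c'-old {f} f∈ with f ≟A e
      ... | yes refl = contradiction f∈ e∉
      ... | no _ = refl

      bounded' : Bounded c' (e ∷ es)
      bounded' (here refl) = subst (_< k) (sym c'-new) α<k
      bounded' (there f∈) = subst (_< k) (sym (c'-old f∈)) (bounded f∈)

      properAt' : ∀ {v} → ProperAt v c es → Free v c es e α → ProperAt v c' (e ∷ es)
      properAt' _ _ (here refl) (here refl) e≢e _ _ = e≢e refl
      properAt' _ free (here refl) (there g∈) _ ve≡vg c'≡ =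
        free g∈ (sym ve≡vg) (trans (sym (c'-old g∈)) (trans (sym c'≡) c'-new))
      properAt' _ free (there f∈) (here refl) _ vf≡ve c'≡ =
        free f∈ vf≡ve (trans (sym (c'-old f∈)) (trans c'≡ c'-new))
      properAt' properAt _ (there f∈) (there g∈) f≢g vf≡vg c'≡ =
        properAt f∈ g∈ f≢g vf≡vg (trans (sym (c'-old f∈)) (trans c'≡ (c'-old g∈)))

  -- König's edge-colouring theorem: the labellings say that every vertex meets at most k edges.
  konig : ∀ {labL labR} es → Bounded labL es → Bounded labR es →
          ProperAt l labL es → ProperAt r labR es → ∃ λ c → Bounded c es × ProperOn c es
  konig [] _ _ _ _ = (λ _ → 0) , (λ ()) , (λ ()) , (λ ())
  konig (e ∷ es) boundedL boundedR labelsL labelsR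
    with konig es (Bounded-tail boundedL) (Bounded-tail boundedR)
                  (ProperAt-tail labelsL) (ProperAt-tail labelsR)
  ... | c , bounded , proper with e ∈? es
  ...   | yes e∈ = c , bounded ∘ drop , widen (proj₁ proper) , widen (proj₂ proper)
    where
      drop : ∀ {f} → f ∈ e ∷ es → f ∈ es
      drop (here refl) = e∈
      drop (there f∈) = f∈
      widen : ∀ {v} → ProperAt v c es → ProperAt v c (e ∷ es)
      widen properAt f∈ g∈ = properAt (drop f∈) (drop g∈)
  ...   | no e∉ with free-colour c boundedL labelsL e∉ | free-colour c boundedR labelsR e∉
  ...     | α , α<k , α-free | β , β<k , β-free with α ≟ β
  ...       | yes refl = extend bounded proper e∉ α<k α-free β-free
  ...       | no α≢β =
    let open KempeChain c proper e α≢β α-free β-free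
    in extend (recoloured-bounded bounded α<k β<k) recoloured-proper e∉ α<k α-free-l α-free-r

count : ∀ {n} → (Fin n → Bool) → ℕ
count {n} f = sum (map (λ y → if f y then 1 else 0) (allFin n))

count-suc : ∀ {n} (f : Fin (suc n) → Bool) → count f ≡ (if f fzero then 1 else 0) + count (f ∘ fsuc)
count-suc {n} f =
  cong ((if f fzero then 1 else 0) +_)
       (cong sum (trans (map-tabulate fsuc indicator) (sym (map-tabulate (λ y → y) (indicator ∘ fsuc)))))
  where
    indicator : Fin (suc n) → ℕ
    indicator y = if f y then 1 else 0

rank : ∀ {n} → (Fin n → Bool) → Fin n → ℕ
rank f fzero = 0
rank f (fsuc y) = (if f fzero then 1 else 0) + rank (f ∘ fsuc) y

rank<count : ∀ {n} (f : Fin n → Bool) {y} → f y ≡ true → rank f y < count f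
rank<count {suc n} f {fzero} fy rewrite count-suc f | fy = s≤s z≤n
rank<count {suc n} f {fsuc y} fy rewrite count-suc f =
  +-monoʳ-< (if f fzero then 1 else 0) (rank<count (f ∘ fsuc) fy)

rank-<-mono : ∀ {n} (f : Fin n → Bool) {y y'} → f y ≡ true → toℕ y < toℕ y' → rank f y < rank f y'
rank-<-mono f {fzero} {fsuc y'} fy _ rewrite fy = s≤s z≤n
rank-<-mono f {fsuc y} {fsuc y'} fy (s≤s y<y') =
  +-monoʳ-< (if f fzero then 1 else 0) (rank-<-mono (f ∘ fsuc) fy y<y')

rank-injective : ∀ {n} (f : Fin n → Bool) {y y'} → f y ≡ true → f y' ≡ true → rank f y ≡ rank f y' → y ≡ y'
rank-injective f {y} {y'} fy fy' rank≡ with Fin.<-cmp y y'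
... | tri< y<y' _ _ = contradiction rank≡ (<⇒≢ (rank-<-mono f fy y<y'))
... | tri≈ _ y≡y' _ = y≡y'
... | tri> _ _ y'<y = contradiction (sym rank≡) (<⇒≢ (rank-<-mono f fy' y'<y))

rank-surjective : ∀ {n} (f : Fin n → Bool) {t} → t < count f → ∃ λ y → f y ≡ true × rank f y ≡ t
rank-surjective {suc n} f {t} t< rewrite count-suc f with f fzero in fy
rank-surjective {suc n} f {zero} _ | true = fzero , fy , refl
rank-surjective {suc n} f {suc t} (s≤s t<) | true with rank-surjective (f ∘ fsuc) t<
... | y , fy' , rank≡ =
  fsuc y , fy' , trans (cong (λ b → (if b then 1 else 0) + rank (f ∘ fsuc) y) fy) (cong suc rank≡)
rank-surjective {suc n} f {t} t< | false with rank-surjective (f ∘ fsuc) t<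
... | y , fy' , rank≡ = fsuc y , fy' , trans (cong (λ b → (if b then 1 else 0) + rank (f ∘ fsuc) y) fy) rank≡

div-mod-injective : ∀ {a b} n .{{_ : NonZero n}} → a / n ≡ b / n → a % n ≡ b % n → a ≡ b
div-mod-injective {a} {b} n a/n≡b/n a%n≡b%n = begin
  a                 ≡⟨ m≡m%n+[m/n]*n a n ⟩
  a % n + a / n * n ≡⟨ cong₂ (λ u v → u + v * n) a%n≡b%n a/n≡b/n ⟩
  b % n + b / n * n ≡⟨ sym (m≡m%n+[m/n]*n b n) ⟩
  b                 ∎
  where open ≡-Reasoning

[m*2+q]/2≡m : ∀ m {q} → q < 2 → (m * 2 + q) / 2 ≡ m
[m*2+q]/2≡m m {q} q<2 = begin
  (m * 2 + q) / 2   ≡⟨ +-distrib-/-∣ˡ q (n∣m*n m) ⟩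
  m * 2 / 2 + q / 2 ≡⟨ cong₂ _+_ (m*n/n≡m m 2) (m<n⇒m/n≡0 q<2) ⟩
  m + 0             ≡⟨ +-identityʳ m ⟩
  m                 ∎
  where open ≡-Reasoning

1∸p<2 : ∀ p → 1 ∸ p < 2
1∸p<2 p = s≤s (m∸n≤m 1 p)

p≢1∸p : ∀ {p} → p < 2 → p ≢ 1 ∸ p
p≢1∸p {zero} _ ()
p≢1∸p {suc zero} _ ()

-- The ten colours form five blocks {2i, 2i + 1}. A window w ≤ 2 is the run of blocks w, w + 1, w + 2,
-- and block b < 3 of the block colouring is placed at the block of the window congruent to it mod 3.
slot : ℕ → ℕ → ℕ
slot w b = if b <ᵇ w then b + 3 else b

windowColour : ℕ → ℕ → ℕ → ℕ
windowColour w b q = slot w b * 2 + q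

Occurs : (ℕ → ℕ → Set) → ℕ → (ℕ → Set) → Set
Occurs P w R = ∃ λ b → b < 3 × ∃ λ q → q < 2 × P b q × R (windowColour w b q)

IntervalWindow : (ℕ → ℕ → Set) → ℕ → Set
IntervalWindow P w = ∀ {k} → k < 10 → Occurs P w (_≤ k) → Occurs P w (k ≤_) → Occurs P w (_≡ k)

occurs? : ∀ {P R} → (∀ b q → Dec (P b q)) → (∀ c → Dec (R c)) → ∀ w → Dec (Occurs P w R)
occurs? P? R? w = anyUpTo? (λ b → anyUpTo? (λ q → P? b q ×-dec R? (windowColour w b q)) 2) 3

intervalWindow? : ∀ {P} → (∀ b q → Dec (P b q)) → ∀ w → Dec (IntervalWindow P w)
intervalWindow? P? w =
  allUpTo? (λ k → occurs? P? (_≤? k) w →-dec (occurs? P? (k ≤?_) w →-dec occurs? P? (_≟ k) w)) 10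

SamePattern : (ℕ → ℕ → Set) → (ℕ → ℕ → Set) → Set
SamePattern P P' = ∀ {b q} → b < 3 → q < 2 → P b q ⇔ P' b q

Occurs-map : ∀ {P P' w R} → (∀ {b q} → b < 3 → q < 2 → P b q → P' b q) → Occurs P w R → Occurs P' w R
Occurs-map f (b , b<3 , q , q<2 , pbq , r) = b , b<3 , q , q<2 , f b<3 q<2 pbq , r

IntervalWindow-cong : ∀ {P P' w} → SamePattern P P' → IntervalWindow P w → IntervalWindow P' w
IntervalWindow-cong {P} {P'} {w} same window {k} k<10 lo hi =
  Occurs-map {w = w} {R = _≡ k} (λ b<3 q<2 → Equivalence.to (same b<3 q<2))
    (window k<10 (Occurs-map {w = w} {R = _≤ k} from lo) (Occurs-map {w = w} {R = k ≤_} from hi))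
  where
    from : ∀ {b q} → b < 3 → q < 2 → P' b q → P b q
    from b<3 q<2 = Equivalence.from (same b<3 q<2)

slot%3 : ∀ w {b} → b < 3 → slot w b % 3 ≡ b
slot%3 w {b} b<3 with b <ᵇ w
... | true = trans ([m+n]%n≡m%n b 3) (m<n⇒m%n≡m b<3)
... | false = m<n⇒m%n≡m b<3

windowColour-injective : ∀ {w w' b b' q q'} → b < 3 → b' < 3 → q < 2 → q' < 2 →
                         windowColour w b q ≡ windowColour w' b' q' → b ≡ b' × q ≡ q'
windowColour-injective {w} {w'} {b} {b'} {q} {q'} b<3 b'<3 q<2 q'<2 colour≡ =
  trans (sym (slot%3 w b<3)) (trans (cong (_% 3) slot≡) (slot%3 w' b'<3)) ,
  +-cancelˡ-≡ (slot w b * 2) q q' (trans colour≡ (cong (λ s → s * 2 + q') (sym slot≡)))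
  where
    slot≡ : slot w b ≡ slot w' b'
    slot≡ = trans (sym ([m*2+q]/2≡m (slot w b) q<2))
                  (trans (cong (_/ 2) colour≡) ([m*2+q]/2≡m (slot w' b') q'<2))

-- Finite facts checked by evaluation; opaque, so that they are never unfolded when used.
opaque
  two-values : ∀ {p₀} → p₀ < 2 → ∀ {p₁} → p₁ < 2 → ∀ {q} → q < 2 → p₀ ≢ p₁ → p₀ ≡ q ⊎ p₁ ≡ q
  two-values = toWitness {a? = allUpTo? (λ p₀ → allUpTo? (λ p₁ → allUpTo? (λ q →
    ¬? (p₀ ≟ p₁) →-dec (p₀ ≟ q ⊎-dec p₁ ≟ q)) 2) 2) 2} tt

  other-parity : ∀ {σ} → σ < 2 → ∀ {p} → p < 2 → ∀ {p'} → p' < 2 → p ≢ σ → p' ≢ σ → p ≡ p'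
  other-parity = toWitness {a? = allUpTo? (λ σ → allUpTo? (λ p → allUpTo? (λ p' →
    ¬? (p ≟ σ) →-dec (¬? (p' ≟ σ) →-dec (p ≟ p'))) 2) 2) 2} tt

  cover-three : ∀ {a} → a < 3 → ∀ {b} → b < 3 → ∀ {c} → c < 3 → a ≢ b → a ≢ c → b ≢ c →
                ∀ {t} → t < 3 → t ≡ a ⊎ t ≡ b ⊎ t ≡ c
  cover-three = toWitness {a? = allUpTo? (λ a → allUpTo? (λ b → allUpTo? (λ c →
    ¬? (a ≟ b) →-dec (¬? (a ≟ c) →-dec (¬? (b ≟ c) →-dec
    allUpTo? (λ t → t ≟ a ⊎-dec t ≟ b ⊎-dec t ≟ c) 3))) 3) 3) 3} tt

  third : ∀ {a} → a < 3 → ∀ {b} → b < 3 → ∃ λ d → d < 3 × d ≢ a × d ≢ b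
  third = toWitness {a? = allUpTo? (λ a → allUpTo? (λ b →
    anyUpTo? (λ d → ¬? (d ≟ a) ×-dec ¬? (d ≟ b)) 3) 3) 3} tt

  below-five : ∀ {r} → r < 5 → r ≡ 4 ⊎ r / 2 ≡ 0 ⊎ r / 2 ≡ 1
  below-five = toWitness {a? = allUpTo? (λ r → r ≟ 4 ⊎-dec r / 2 ≟ 0 ⊎-dec r / 2 ≟ 1) 5} tt

  windowColour<10 : ∀ {w} → w < 3 → ∀ {b} → b < 3 → ∀ {q} → q < 2 → windowColour w b q < 10
  windowColour<10 = toWitness {a? = allUpTo? (λ w → allUpTo? (λ b → allUpTo? (λ q →
    suc (windowColour w b q) ≤? 10) 2) 3) 3} tt

  full-window : IntervalWindow (λ _ _ → ⊤) 0
  full-window = toWitness {a? = intervalWindow? (λ _ _ → yes tt) 0} tt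

  avoiding-window : ∀ {a} → a < 3 → ∃ λ w → w < 3 × IntervalWindow (λ b _ → b ≢ a) w
  avoiding-window = toWitness {a? = allUpTo? (λ a → anyUpTo? (intervalWindow? (λ b _ → ¬? (b ≟ a))) 3) 3} tt

  block-window : ∀ {d} → d < 3 → IntervalWindow (λ b _ → b ≡ d) 0
  block-window = toWitness {a? = allUpTo? (λ d → intervalWindow? (λ b _ → b ≟ d) 0) 3} tt

  single-window : ∀ {d} → d < 3 → ∀ {s} → s < 2 → IntervalWindow (λ b q → b ≡ d × q ≡ s) 0
  single-window = toWitness {a? = allUpTo? (λ d → allUpTo? (λ s →
    intervalWindow? (λ b q → b ≟ d ×-dec q ≟ s) 0) 2) 3} tt

  co-single-window : ∀ {d} → d < 3 → ∀ {s} → s < 2 → ∃ λ w → w < 3 × IntervalWindow (λ b q → b ≢ d ⊎ q ≡ s) w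
  co-single-window = toWitness {a? = allUpTo? (λ d → allUpTo? (λ s →
    anyUpTo? (intervalWindow? (λ b q → ¬? (b ≟ d) ⊎-dec q ≟ s)) 3) 2) 3} tt

lit : ∀ {m n} {_ : True (m ≤? n)} → m ≤ n
lit {m} {n} {m≤n} = toWitness m≤n

module Graph (G : BipGraph) where

  X Y : Set
  X = Fin (m G)
  Y = Fin (n G)

  edges : List (X × Y)
  edges = filter (λ (x , y) → adj G x y Bool.≟ true) (cartesianProduct (allFin (m G)) (allFin (n G)))

  ∈-edges : ∀ {x y} → Edge G x y → (x , y) ∈ edges
  ∈-edges {x} {y} xy = ∈-filter⁺ _ (∈-cartesianProduct⁺ (∈-allFin x) (∈-allFin y)) xy

  edges-Edge : ∀ {x y} → (x , y) ∈ edges → Edge G x y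
  edges-Edge xy∈ = proj₂ (∈-filter⁻ _ {xs = cartesianProduct (allFin (m G)) (allFin (n G))} xy∈)

  rankX rankY pairX pairY : X → Y → ℕ
  rankX x y = rank (adj G x) y
  rankY x y = rank (λ x' → adj G x' y) x
  pairX x y = rankX x y / 2
  pairY x y = rankY x y / 2

  rankX<degX : ∀ {x y} → Edge G x y → rankX x y < degX G x
  rankX<degX {x} = rank<count (adj G x)

  rankY<degY : ∀ {x y} → Edge G x y → rankY x y < degY G y
  rankY<degY {y = y} = rank<count (λ x' → adj G x' y)

  Vertex : Set
  Vertex = X ⊎ Y

  _≟E_ : DecidableEquality (X × Y)
  _≟E_ = Product.≡-dec Fin._≟_ (λ {_} → Fin._≟_)

  _≟V_ : DecidableEquality Vertex
  _≟V_ = Sum.≡-dec Fin._≟_ Fin._≟_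

  -- The vertex (v , i) of the graph of pairs holds the edges of rank 2i and 2i + 1 at v.
  pairEndX pairEndY : X × Y → Vertex × ℕ
  pairEndX (x , y) = inj₁ x , pairX x y
  pairEndY (x , y) = inj₂ y , pairY x y

  module Pairs = Konig _≟E_ (Product.≡-dec _≟V_ (λ {_} → _≟_)) pairEndX pairEndY 2

  pairs-labelsX : Pairs.ProperAt pairEndX (λ (x , y) → rankX x y % 2) edges
  pairs-labelsX {x , y} {x' , y'} xy∈ x'y'∈ xy≢x'y' ends≡ %≡
    with Sum.inj₁-injective (proj₁ (Product.,-injective ends≡))
  ... | refl = xy≢x'y' (cong (x ,_) (rank-injective (adj G x) (edges-Edge xy∈) (edges-Edge x'y'∈)
                   (div-mod-injective 2 (Product.,-injectiveʳ ends≡) %≡)))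

  pairs-labelsY : Pairs.ProperAt pairEndY (λ (x , y) → rankY x y % 2) edges
  pairs-labelsY {x , y} {x' , y'} xy∈ x'y'∈ xy≢x'y' ends≡ %≡
    with Sum.inj₂-injective (proj₁ (Product.,-injective ends≡))
  ... | refl = xy≢x'y' (cong (_, y) (rank-injective (λ x'' → adj G x'' y) (edges-Edge xy∈) (edges-Edge x'y'∈)
                   (div-mod-injective 2 (Product.,-injectiveʳ ends≡) %≡)))

  opaque
    parityColouring : ∃ λ c → Pairs.Bounded c edges × Pairs.ProperOn c edges
    parityColouring = Pairs.konig edges (λ {(x , y)} _ → m%n<n (rankX x y) 2)
                                        (λ {(x , y)} _ → m%n<n (rankY x y) 2)
                                        pairs-labelsX pairs-labelsY

  parity : X → Y → ℕ
  parity x y = proj₁ parityColouring (x , y)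

  parity<2 : ∀ {x y} → Edge G x y → parity x y < 2
  parity<2 xy = proj₁ (proj₂ parityColouring) (∈-edges xy)

  parity-properX : Pairs.ProperAt pairEndX (proj₁ parityColouring) edges
  parity-properX = proj₁ (proj₂ (proj₂ parityColouring))

  parity-properY : Pairs.ProperAt pairEndY (proj₁ parityColouring) edges
  parity-properY = proj₂ (proj₂ (proj₂ parityColouring))

  pair-parity-uniqueX : ∀ {x y y'} → Edge G x y → Edge G x y' →
                        pairX x y ≡ pairX x y' → parity x y ≡ parity x y' → y ≡ y'
  pair-parity-uniqueX {x} xy xy' pair≡ parity≡ = Product.,-injectiveʳ
    (Pairs.ProperAt-unique parity-properX (∈-edges xy) (∈-edges xy') (cong (inj₁ x ,_) pair≡) parity≡)

  pair-parity-uniqueY : ∀ {x x' y} → Edge G x y → Edge G x' y →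
                        pairY x y ≡ pairY x' y → parity x y ≡ parity x' y → x ≡ x'
  pair-parity-uniqueY {y = y} xy x'y pair≡ parity≡ = proj₁ (Product.,-injective
    (Pairs.ProperAt-unique parity-properY (∈-edges xy) (∈-edges x'y) (cong (inj₂ y ,_) pair≡) parity≡))

  -- The edges of ranks 2j and 2j + 1 at x form a pair and so receive both parities.
  full-pair : ∀ {x j q} → j * 2 + 1 < degX G x → q < 2 → ∃ λ y → Edge G x y × pairX x y ≡ j × parity x y ≡ q
  full-pair {x} {j} {q} full q<2 =
    let y₀ , xy₀ , rank₀ = member {0} (s≤s z≤n)
        y₁ , xy₁ , rank₁ = member {1} (s≤s (s≤s z≤n))
        pair₀ : pairX x y₀ ≡ j
        pair₀ = trans (cong (_/ 2) rank₀) ([m*2+q]/2≡m j (s≤s z≤n))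
        pair₁ : pairX x y₁ ≡ j
        pair₁ = trans (cong (_/ 2) rank₁) ([m*2+q]/2≡m j (s≤s (s≤s z≤n)))
        y₀≢y₁ : (x , y₀) ≢ (x , y₁)
        y₀≢y₁ eq = <⇒≢ (+-monoʳ-< (j * 2) (s≤s z≤n))
                     (trans (sym rank₀) (trans (cong (rankX x) (Product.,-injectiveʳ eq)) rank₁))
        parity₀≢parity₁ : parity x y₀ ≢ parity x y₁
        parity₀≢parity₁ = parity-properX (∈-edges xy₀) (∈-edges xy₁) y₀≢y₁
                            (cong (inj₁ x ,_) (trans pair₀ (sym pair₁)))
    in [ (λ parity₀≡q → y₀ , xy₀ , pair₀ , parity₀≡q) , (λ parity₁≡q → y₁ , xy₁ , pair₁ , parity₁≡q) ]′
         (two-values (parity<2 xy₀) (parity<2 xy₁) q<2 parity₀≢parity₁)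
    where
      member : ∀ {i} → i < 2 → ∃ λ y → Edge G x y × rankX x y ≡ j * 2 + i
      member i<2 = rank-surjective (adj G x) (≤-<-trans (+-monoʳ-≤ (j * 2) (≤-pred i<2)) full)

  module Blocks (degX≤6 : ∀ x → degX G x ≤ 6) (degY≤6 : ∀ y → degY G y ≤ 6) where

    pairX<3 : ∀ {x y} → Edge G x y → pairX x y < 3
    pairX<3 xy = m<n*o⇒m/o<n (<-≤-trans (rankX<degX xy) (degX≤6 _))

    pairY<3 : ∀ {x y} → Edge G x y → pairY x y < 3
    pairY<3 xy = m<n*o⇒m/o<n (<-≤-trans (rankY<degY xy) (degY≤6 _))

    pairX-below-degree : ∀ {x y j} → Edge G x y → degX G x ≤ j * 2 → pairX x y ≢ j
    pairX-below-degree {x} {y} xy deg≤ refl =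
      <-irrefl refl (<-≤-trans (<-≤-trans (rankX<degX xy) deg≤) (m/n*n≤m (rankX x y) 2))

    -- The link (x , j) stands for the pair j at x, which is empty.
    QEdge : Set
    QEdge = (X × Y) ⊎ (X × ℕ)

    IsQEdge : QEdge → Set
    IsQEdge (inj₁ (x , y)) = Edge G x y
    IsQEdge (inj₂ (x , j)) = j < 3 × degX G x ≤ j * 2

    _≟Q_ : DecidableEquality QEdge
    _≟Q_ = Sum.≡-dec _≟E_ (Product.≡-dec Fin._≟_ (λ {_} → _≟_))

    links : List (X × ℕ)
    links = filter (λ (x , j) → degX G x ≤? j * 2) (cartesianProduct (allFin (m G)) (upTo 3))

    qEdges : List QEdge
    qEdges = map inj₁ edges ++ map inj₂ links

    qEdges-complete : ∀ {e} → IsQEdge e → e ∈ qEdges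
    qEdges-complete {inj₁ (x , y)} xy = ∈-++⁺ˡ (∈-map⁺ inj₁ (∈-edges xy))
    qEdges-complete {inj₂ (x , j)} (j<3 , deg≤) =
      ∈-++⁺ʳ (map inj₁ edges) (∈-map⁺ inj₂ (∈-filter⁺ _ (∈-cartesianProduct⁺ (∈-allFin x) (∈-upTo⁺ j<3)) deg≤))

    qEdges-sound : ∀ {e} → e ∈ qEdges → IsQEdge e
    qEdges-sound e∈ with ∈-++⁻ (map inj₁ edges) e∈
    ... | inj₁ e∈₁ with ∈-map⁻ inj₁ e∈₁
    ...   | _ , xy∈ , refl = edges-Edge xy∈
    qEdges-sound e∈ | inj₂ e∈₂ with ∈-map⁻ inj₂ e∈₂
    ...   | (x , j) , xj∈ , refl with ∈-filter⁻ _ {xs = cartesianProduct (allFin (m G)) (upTo 3)} xj∈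
    ...     | xj∈product , deg≤ =
      ∈-upTo⁻ (proj₂ (∈-cartesianProduct⁻ (allFin (m G)) (upTo 3) xj∈product)) , deg≤

    -- Q has two copies (v , 0), (v , 1) of each vertex v of G: the copy (v , q) meets the edges of parity
    -- q at v and, for v ∈ X, the links, which join (x , 0) to (x , 1). Its sides are {(x , σ), (y , 1 ∸ σ)}
    -- for σ = 0, 1, and qEnd σ e is the vertex of G whose copy is the end of e on side σ. Labelling edges
    -- by their pair (links by j) shows that Q has maximum degree 3.
    qEnd : ℕ → QEdge → Vertex
    qEnd σ (inj₁ (x , y)) with parity x y ≟ σ
    ... | yes _ = inj₁ x
    ... | no _ = inj₂ y
    qEnd σ (inj₂ (x , _)) = inj₁ x

    qLabel : ℕ → QEdge → ℕ
    qLabel σ (inj₁ (x , y)) with parity x y ≟ σ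
    ... | yes _ = pairX x y
    ... | no _ = pairY x y
    qLabel σ (inj₂ (_ , j)) = j

    qEnd-at-x : ∀ {σ x y} → parity x y ≡ σ →
                qEnd σ (inj₁ (x , y)) ≡ inj₁ x × qLabel σ (inj₁ (x , y)) ≡ pairX x y
    qEnd-at-x {σ} {x} {y} parity≡σ with parity x y ≟ σ
    ... | yes _ = refl , refl
    ... | no parity≢σ = contradiction parity≡σ parity≢σ

    qEnd-at-y : ∀ {σ x y} → parity x y ≢ σ →
                qEnd σ (inj₁ (x , y)) ≡ inj₂ y × qLabel σ (inj₁ (x , y)) ≡ pairY x y
    qEnd-at-y {σ} {x} {y} parity≢σ with parity x y ≟ σ
    ... | yes parity≡σ = contradiction parity≡σ parity≢σ
    ... | no _ = refl , refl

    real≢link : ∀ {σ x y x' j} → Edge G x y → degX G x' ≤ j * 2 →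
                qEnd σ (inj₁ (x , y)) ≡ inj₁ x' → qLabel σ (inj₁ (x , y)) ≢ j
    real≢link {σ} {x} {y} xy deg≤ end≡ label≡ with toSum (parity x y ≟ σ)
    ... | inj₁ p≡σ with Sum.inj₁-injective (trans (sym (proj₁ (qEnd-at-x p≡σ))) end≡)
    ...   | refl = pairX-below-degree xy deg≤ (trans (sym (proj₂ (qEnd-at-x p≡σ))) label≡)
    real≢link {σ} {x} {y} xy deg≤ end≡ label≡ | inj₂ p≢σ =
      case trans (sym (proj₁ (qEnd-at-y p≢σ))) end≡ of λ ()

    x-end≢y-end : ∀ {σ x y x' y'} → parity x y ≡ σ → parity x' y' ≢ σ →
                  qEnd σ (inj₁ (x , y)) ≢ qEnd σ (inj₁ (x' , y'))
    x-end≢y-end p≡σ p'≢σ end≡ =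
      case trans (sym (proj₁ (qEnd-at-x p≡σ))) (trans end≡ (proj₁ (qEnd-at-y p'≢σ))) of λ ()

    reals-unique : ∀ {σ x y x' y'} → σ < 2 → Edge G x y → Edge G x' y' →
                   qEnd σ (inj₁ (x , y)) ≡ qEnd σ (inj₁ (x' , y')) →
                   qLabel σ (inj₁ (x , y)) ≡ qLabel σ (inj₁ (x' , y')) → (x , y) ≡ (x' , y')
    reals-unique {σ} {x} {y} {x'} {y'} σ<2 xy x'y' end≡ label≡
      with toSum (parity x y ≟ σ) | toSum (parity x' y' ≟ σ)
    ... | inj₁ p≡σ | inj₁ p'≡σ with qEnd-at-x p≡σ | qEnd-at-x p'≡σ
    ...   | end , label | end' , label' with Sum.inj₁-injective (trans (sym end) (trans end≡ end'))
    ...     | refl = cong (x ,_) (pair-parity-uniqueX xy x'y' (trans (sym label) (trans label≡ label'))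
                                                          (trans p≡σ (sym p'≡σ)))
    reals-unique {σ} {x} {y} {x'} {y'} σ<2 xy x'y' end≡ label≡ | inj₂ p≢σ | inj₂ p'≢σ
      with qEnd-at-y p≢σ | qEnd-at-y p'≢σ
    ... | end , label | end' , label' with Sum.inj₂-injective (trans (sym end) (trans end≡ end'))
    ...   | refl = cong (_, y) (pair-parity-uniqueY xy x'y' (trans (sym label) (trans label≡ label'))
                                   (other-parity σ<2 (parity<2 xy) (parity<2 x'y') p≢σ p'≢σ))
    reals-unique σ<2 xy x'y' end≡ label≡ | inj₁ p≡σ | inj₂ p'≢σ = ⊥-elim (x-end≢y-end p≡σ p'≢σ end≡)
    reals-unique σ<2 xy x'y' end≡ label≡ | inj₂ p≢σ | inj₁ p'≡σ = ⊥-elim (x-end≢y-end p'≡σ p≢σ (sym end≡))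

    qLabels-unique : ∀ {σ e f} → σ < 2 → IsQEdge e → IsQEdge f →
                     qEnd σ e ≡ qEnd σ f → qLabel σ e ≡ qLabel σ f → e ≡ f
    qLabels-unique {e = inj₁ _} {inj₁ _} σ<2 xy x'y' end≡ label≡ =
      cong inj₁ (reals-unique σ<2 xy x'y' end≡ label≡)
    qLabels-unique {e = inj₁ _} {inj₂ _} σ<2 xy (_ , deg≤) end≡ label≡ = ⊥-elim (real≢link xy deg≤ end≡ label≡)
    qLabels-unique {e = inj₂ _} {inj₁ _} σ<2 (_ , deg≤) xy end≡ label≡ =
      ⊥-elim (real≢link xy deg≤ (sym end≡) (sym label≡))
    qLabels-unique {e = inj₂ _} {inj₂ _} σ<2 _ _ end≡ refl with Sum.inj₁-injective end≡
    ... | refl = refl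

    module Q = Konig _≟Q_ _≟V_ (qEnd 0) (qEnd 1) 3

    qLabels-proper : ∀ {σ} → σ < 2 → Q.ProperAt (qEnd σ) (qLabel σ) qEdges
    qLabels-proper σ<2 e∈ f∈ e≢f end≡ label≡ =
      e≢f (qLabels-unique σ<2 (qEdges-sound e∈) (qEdges-sound f∈) end≡ label≡)

    qLabels-bounded : ∀ σ → Q.Bounded (qLabel σ) qEdges
    qLabels-bounded σ {e} e∈ = bounded e (qEdges-sound e∈)
      where
        bounded : ∀ e → IsQEdge e → qLabel σ e < 3
        bounded (inj₁ (x , y)) xy with toSum (parity x y ≟ σ)
        ... | inj₁ p≡σ = subst (_< 3) (sym (proj₂ (qEnd-at-x p≡σ))) (pairX<3 xy)
        ... | inj₂ p≢σ = subst (_< 3) (sym (proj₂ (qEnd-at-y p≢σ))) (pairY<3 xy)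
        bounded (inj₂ (x , j)) (j<3 , _) = j<3

    opaque
      blockColouring : ∃ λ c → Q.Bounded c qEdges × Q.ProperOn c qEdges
      blockColouring = Q.konig qEdges (qLabels-bounded 0) (qLabels-bounded 1)
                         (qLabels-proper (s≤s z≤n)) (qLabels-proper (s≤s (s≤s z≤n)))

    block : X → Y → ℕ
    block x y = proj₁ blockColouring (inj₁ (x , y))

    linkColour : X → ℕ → ℕ
    linkColour x j = proj₁ blockColouring (inj₂ (x , j))

    block<3 : ∀ {x y} → Edge G x y → block x y < 3
    block<3 xy = proj₁ (proj₂ blockColouring) (qEdges-complete xy)

    linkColour<3 : ∀ {x j} → j < 3 → degX G x ≤ j * 2 → linkColour x j < 3
    linkColour<3 j<3 deg≤ = proj₁ (proj₂ blockColouring) (qEdges-complete (j<3 , deg≤))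

    block-properAt : ∀ {σ} → σ < 2 → Q.ProperAt (qEnd σ) (proj₁ blockColouring) qEdges
    block-properAt (s≤s z≤n) = proj₁ (proj₂ (proj₂ blockColouring))
    block-properAt (s≤s (s≤s z≤n)) = proj₂ (proj₂ (proj₂ blockColouring))

    block-distinctX : ∀ {x y y'} → Edge G x y → Edge G x y' → y ≢ y' →
                      parity x y ≡ parity x y' → block x y ≢ block x y'
    block-distinctX {x} xy xy' y≢y' parity≡ =
      block-properAt (parity<2 xy) (qEdges-complete xy) (qEdges-complete xy')
        (λ eq → y≢y' (Product.,-injectiveʳ (Sum.inj₁-injective eq)))
        (trans (proj₁ (qEnd-at-x refl)) (sym (proj₁ (qEnd-at-x (sym parity≡)))))

    block-distinctY : ∀ {x x' y} → Edge G x y → Edge G x' y → x ≢ x' →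
                      parity x y ≡ parity x' y → block x y ≢ block x' y
    block-distinctY {x} {x'} {y} xy x'y x≢x' parity≡ =
      block-properAt (1∸p<2 (parity x y)) (qEdges-complete xy) (qEdges-complete x'y)
        (λ eq → x≢x' (proj₁ (Product.,-injective (Sum.inj₁-injective eq))))
        (trans (proj₁ (qEnd-at-y p≢σ)) (sym (proj₁ (qEnd-at-y (subst (_≢ 1 ∸ parity x y) parity≡ p≢σ)))))
      where
        p≢σ : parity x y ≢ 1 ∸ parity x y
        p≢σ = p≢1∸p (parity<2 xy)

    block≢linkColour : ∀ {x y j} → Edge G x y → j < 3 → degX G x ≤ j * 2 → block x y ≢ linkColour x j
    block≢linkColour xy j<3 deg≤ =
      block-properAt (parity<2 xy) (qEdges-complete xy) (qEdges-complete (j<3 , deg≤)) (λ ()) (proj₁ (qEnd-at-x refl))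

    linkColours-distinct : ∀ {x j j'} → j < 3 → degX G x ≤ j * 2 → j' < 3 → degX G x ≤ j' * 2 → j ≢ j' →
                           linkColour x j ≢ linkColour x j'
    linkColours-distinct j<3 deg≤ j'<3 deg≤' j≢j' =
      block-properAt {0} (s≤s z≤n) (qEdges-complete (j<3 , deg≤)) (qEdges-complete (j'<3 , deg≤'))
        (λ eq → j≢j' (Product.,-injectiveʳ (Sum.inj₂-injective eq))) refl

    Present : X → ℕ → ℕ → Set
    Present x b q = ∃ λ y → Edge G x y × block x y ≡ b × parity x y ≡ q

    colouring : (X → ℕ) → Colouring G
    colouring W x y = windowColour (W x) (block x y) (parity x y)

    colouring-proper : ∀ W → Proper G (colouring W)
    colouring-proper W =
      (λ x y y' xy xy' y≢y' colour≡ →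
        let block≡ , parity≡ = windowColour-injective {W x} {W x} (block<3 xy) (block<3 xy')
                                                      (parity<2 xy) (parity<2 xy') colour≡
        in block-distinctX xy xy' y≢y' parity≡ block≡) ,
      (λ y x x' xy x'y x≢x' colour≡ →
        let block≡ , parity≡ = windowColour-injective {W x} {W x'} (block<3 xy) (block<3 x'y)
                                                      (parity<2 xy) (parity<2 x'y) colour≡
        in block-distinctY xy x'y x≢x' parity≡ block≡)

    GoodWindows : (X → ℕ) → Set
    GoodWindows W = ∀ x → W x < 3 × IntervalWindow (Present x) (W x)

    colouring-bounded : ∀ {W} → GoodWindows W → ∀ {x y} → Edge G x y → colouring W x y < 10
    colouring-bounded good {x} xy = windowColour<10 (proj₁ (good x)) (block<3 xy) (parity<2 xy)

    colouring-interval : ∀ {W} → GoodWindows W → XInterval G (colouring W)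
    colouring-interval {W} good x y y' k xy xy' lo hi
      with proj₂ (good x) (≤-<-trans hi (colouring-bounded good xy'))
             (block x y , block<3 xy , parity x y , parity<2 xy , (y , xy , refl , refl) , lo)
             (block x y' , block<3 xy' , parity x y' , parity<2 xy' , (y' , xy' , refl , refl) , hi)
    ... | _ , _ , _ , _ , (y'' , xy'' , refl , refl) , colour≡k = y'' , xy'' , colour≡k

    colouring-χint≤10 : ∀ {W} → GoodWindows W → χint≤ G 10
    colouring-χint≤10 {W} good = colouring W , (colouring-proper W , colouring-interval good) ,
                                  λ x y xy → colouring-bounded good xy

    degX-above : ∀ {x d i} → degX G x ≡ d → i < d → i < degX G x
    degX-above deg≡ i<d = subst (_ <_) (sym deg≡) i<d

    degX-below : ∀ {x d} j → degX G x ≡ d → d ≤ j * 2 → degX G x ≤ j * 2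
    degX-below j deg≡ d≤ = subst (_≤ j * 2) (sym deg≡) d≤

    distinct-pairs : ∀ {x y y' j j'} → pairX x y ≡ j → pairX x y' ≡ j' → j ≢ j' → y ≢ y'
    distinct-pairs pair≡j pair≡j' j≢j' refl = j≢j' (trans (sym pair≡j) pair≡j')

    cover-with : ∀ {x q y₀ y₁ a} → Edge G x y₀ → Edge G x y₁ → parity x y₀ ≡ q → parity x y₁ ≡ q → y₀ ≢ y₁ →
                 a < 3 → block x y₀ ≢ a → block x y₁ ≢ a → ∀ {b} → b < 3 → Present x b q ⊎ b ≡ a
    cover-with xy₀ xy₁ p₀ p₁ y₀≢y₁ a<3 b₀≢a b₁≢a b<3
      with cover-three (block<3 xy₀) (block<3 xy₁) a<3 (block-distinctX xy₀ xy₁ y₀≢y₁ (trans p₀ (sym p₁)))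
                       b₀≢a b₁≢a b<3
    ... | inj₁ b≡b₀ = inj₁ (_ , xy₀ , sym b≡b₀ , p₀)
    ... | inj₂ (inj₁ b≡b₁) = inj₁ (_ , xy₁ , sym b≡b₁ , p₁)
    ... | inj₂ (inj₂ b≡a) = inj₂ b≡a

    cover-by-three : ∀ {x q y₀ y₁ y₂} → Edge G x y₀ → Edge G x y₁ → Edge G x y₂ →
                     parity x y₀ ≡ q → parity x y₁ ≡ q → parity x y₂ ≡ q → y₀ ≢ y₁ → y₀ ≢ y₂ → y₁ ≢ y₂ →
                     ∀ {b} → b < 3 → Present x b q
    cover-by-three xy₀ xy₁ xy₂ p₀ p₁ p₂ y₀≢y₁ y₀≢y₂ y₁≢y₂ b<3
      with cover-with xy₀ xy₁ p₀ p₁ y₀≢y₁ (block<3 xy₂) (block-distinctX xy₀ xy₂ y₀≢y₂ (trans p₀ (sym p₂)))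
                      (block-distinctX xy₁ xy₂ y₁≢y₂ (trans p₁ (sym p₂))) b<3
    ... | inj₁ present = present
    ... | inj₂ b≡b₂ = _ , xy₂ , sym b≡b₂ , p₂

    degree6-window : ∀ {x} → degX G x ≡ 6 → IntervalWindow (Present x) 0
    degree6-window {x} deg≡6 =
      IntervalWindow-cong {w = 0} (λ b<3 q<2 → mk⇔ (λ _ → all-blocks b<3 q<2) (λ _ → tt)) full-window
      where
        all-blocks : ∀ {b q} → b < 3 → q < 2 → Present x b q
        all-blocks b<3 q<2 =
          let _ , xy₀ , pair₀ , p₀ = full-pair {j = 0} (degX-above deg≡6 lit) q<2
              _ , xy₁ , pair₁ , p₁ = full-pair {j = 1} (degX-above deg≡6 lit) q<2
              _ , xy₂ , pair₂ , p₂ = full-pair {j = 2} (degX-above deg≡6 lit) q<2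
          in cover-by-three xy₀ xy₁ xy₂ p₀ p₁ p₂ (distinct-pairs pair₀ pair₁ (λ ()))
               (distinct-pairs pair₀ pair₂ (λ ())) (distinct-pairs pair₁ pair₂ (λ ())) b<3

    degree4-window : ∀ {x} → degX G x ≡ 4 → ∃ λ w → w < 3 × IntervalWindow (Present x) w
    degree4-window {x} deg≡4 with avoiding-window (linkColour<3 {x} lit (degX-below 2 deg≡4 lit))
    ... | w , w<3 , window =
      w , w<3 , IntervalWindow-cong {w = w} (λ b<3 q<2 → mk⇔ (avoiding b<3 q<2) avoids) window
      where
        avoids : ∀ {b q} → Present x b q → b ≢ linkColour x 2
        avoids (_ , xy , refl , _) = block≢linkColour xy lit (degX-below 2 deg≡4 lit)

        avoiding : ∀ {b q} → b < 3 → q < 2 → b ≢ linkColour x 2 → Present x b q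
        avoiding b<3 q<2 b≢a =
          let _ , xy₀ , pair₀ , p₀ = full-pair {j = 0} (degX-above deg≡4 lit) q<2
              _ , xy₁ , pair₁ , p₁ = full-pair {j = 1} (degX-above deg≡4 lit) q<2
          in [ (λ present → present) , (λ b≡a → contradiction b≡a b≢a) ]′
               (cover-with xy₀ xy₁ p₀ p₁ (distinct-pairs pair₀ pair₁ (λ ()))
                 (linkColour<3 lit (degX-below 2 deg≡4 lit)) (avoids (_ , xy₀ , refl , refl))
                 (avoids (_ , xy₁ , refl , refl)) b<3)

    degree2-window : ∀ {x} → degX G x ≡ 2 → IntervalWindow (Present x) 0
    degree2-window {x} deg≡2
      with third (linkColour<3 {x} {1} lit (degX-below 1 deg≡2 lit))
                 (linkColour<3 {x} {2} lit (degX-below 2 deg≡2 lit))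
    ... | d , d<3 , d≢a₁ , d≢a₂ =
      IntervalWindow-cong {w = 0}
        (λ b<3 q<2 → mk⇔ (λ { refl → in-block q<2 }) (λ { (_ , xy , refl , _) → block≡d xy }))
        (block-window d<3)
      where
        block≡d : ∀ {y} → Edge G x y → block x y ≡ d
        block≡d xy
          with cover-three (linkColour<3 {j = 1} lit (degX-below 1 deg≡2 lit))
                           (linkColour<3 {j = 2} lit (degX-below 2 deg≡2 lit)) d<3
                 (linkColours-distinct {j = 1} {2} lit (degX-below 1 deg≡2 lit) lit (degX-below 2 deg≡2 lit)
                   (λ ()))
                 (λ a₁≡d → d≢a₁ (sym a₁≡d)) (λ a₂≡d → d≢a₂ (sym a₂≡d)) (block<3 xy)
        ... | inj₁ b≡a₁ = contradiction b≡a₁ (block≢linkColour {j = 1} xy lit (degX-below 1 deg≡2 lit))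
        ... | inj₂ (inj₁ b≡a₂) = contradiction b≡a₂ (block≢linkColour {j = 2} xy lit (degX-below 2 deg≡2 lit))
        ... | inj₂ (inj₂ b≡d) = b≡d

        in-block : ∀ {q} → q < 2 → Present x d q
        in-block q<2 =
          let y , xy , _ , p = full-pair {j = 0} (degX-above deg≡2 lit) q<2 in y , xy , block≡d xy , p

    degree1-window : ∀ {x} → degX G x ≡ 1 → IntervalWindow (Present x) 0
    degree1-window {x} deg≡1 =
      let s , xs , rank≡0 = rank-surjective (adj G x) (degX-above deg≡1 lit)
          the-edge : ∀ {y} → Edge G x y → y ≡ s
          the-edge {y} xy = rank-injective (adj G x) xy xs
                              (trans (n<1⇒n≡0 (subst (rankX x y <_) deg≡1 (rankX<degX xy))) (sym rank≡0))
      in IntervalWindow-cong {w = 0}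
           (λ b<3 q<2 → mk⇔ (λ { (refl , refl) → s , xs , refl , refl })
                            (λ { (y , xy , refl , refl) → cong (block x) (the-edge xy) , cong (parity x) (the-edge xy) }))
           (single-window (block<3 xs) (parity<2 xs))

    degree5-pattern : ∀ {x s a₀ a₁ d} → degX G x ≡ 5 → Edge G x s → rankX x s ≡ 4 →
                      Edge G x a₀ → Edge G x a₁ → pairX x a₀ ≡ 0 → pairX x a₁ ≡ 1 →
                      parity x a₀ ≢ parity x s → parity x a₁ ≡ parity x a₀ →
                      d < 3 → block x a₀ ≢ d → block x a₁ ≢ d →
                      SamePattern (λ b q → b ≢ d ⊎ q ≡ parity x s) (Present x)
    degree5-pattern {x} {s} {a₀} {a₁} {d} deg≡5 xs rank-s xa₀ xa₁ pair₀ pair₁ p₀≢ps p₁≡p₀ d<3 block₀≢d block₁≢d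
                    b<3 q<2 = mk⇔ (from b<3 q<2) to
      where
        ps<2 : parity x s < 2
        ps<2 = parity<2 xs

        parity-s-covers : ∀ {b} → b < 3 → Present x b (parity x s)
        parity-s-covers b<3 =
          let _ , xy₀ , pair₀' , p₀' = full-pair {j = 0} (degX-above deg≡5 lit) ps<2
              _ , xy₁ , pair₁' , p₁' = full-pair {j = 1} (degX-above deg≡5 lit) ps<2
              pair-s = cong (_/ 2) rank-s
          in cover-by-three xy₀ xy₁ xs p₀' p₁' refl (distinct-pairs pair₀' pair₁' (λ ()))
               (distinct-pairs pair₀' pair-s (λ ())) (distinct-pairs pair₁' pair-s (λ ())) b<3

        from : ∀ {b q} → b < 3 → q < 2 → b ≢ d ⊎ q ≡ parity x s → Present x b q
        from b<3 q<2 (inj₂ refl) = parity-s-covers b<3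
        from {b} {q} b<3 q<2 (inj₁ b≢d) with toSum (q ≟ parity x s)
        ... | inj₁ refl = parity-s-covers b<3
        ... | inj₂ q≢ps with other-parity ps<2 q<2 (parity<2 xa₀) q≢ps p₀≢ps
        ...   | refl = [ (λ present → present) , (λ b≡d → contradiction b≡d b≢d) ]′
                         (cover-with xa₀ xa₁ refl p₁≡p₀ (distinct-pairs pair₀ pair₁ (λ ())) d<3 block₀≢d block₁≢d b<3)

        to : ∀ {b q} → Present x b q → b ≢ d ⊎ q ≡ parity x s
        to (y , xy , refl , refl) with toSum (parity x y ≟ parity x s)
        ... | inj₁ p≡ps = inj₂ p≡ps
        ... | inj₂ p≢ps with below-five (subst (rankX x y <_) deg≡5 (rankX<degX xy))
        ...   | inj₁ rank≡4 =
          contradiction (cong (parity x) (rank-injective (adj G x) xy xs (trans rank≡4 (sym rank-s)))) p≢ps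
        ...   | inj₂ (inj₁ pair≡0) = inj₁ (subst (_≢ d) (cong (block x) (sym y≡a₀)) block₀≢d)
          where
            y≡a₀ : y ≡ a₀
            y≡a₀ = pair-parity-uniqueX xy xa₀ (trans pair≡0 (sym pair₀))
                     (other-parity ps<2 (parity<2 xy) (parity<2 xa₀) p≢ps p₀≢ps)
        ...   | inj₂ (inj₂ pair≡1) = inj₁ (subst (_≢ d) (cong (block x) (sym y≡a₁)) block₁≢d)
          where
            y≡a₁ : y ≡ a₁
            y≡a₁ = pair-parity-uniqueX xy xa₁ (trans pair≡1 (sym pair₁))
                     (trans (other-parity ps<2 (parity<2 xy) (parity<2 xa₀) p≢ps p₀≢ps) (sym p₁≡p₀))

    degree5-window : ∀ {x} → degX G x ≡ 5 → ∃ λ w → w < 3 × IntervalWindow (Present x) w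
    degree5-window {x} deg≡5 with rank-surjective (adj G x) {4} (degX-above deg≡5 lit)
    ... | s , xs , rank-s
      with full-pair {j = 0} (degX-above deg≡5 lit) (1∸p<2 (parity x s))
         | full-pair {j = 1} (degX-above deg≡5 lit) (1∸p<2 (parity x s))
    ... | a₀ , xa₀ , pair₀ , p₀ | a₁ , xa₁ , pair₁ , p₁ with third (block<3 xa₀) (block<3 xa₁)
    ... | d , d<3 , d≢block₀ , d≢block₁ with co-single-window d<3 (parity<2 xs)
    ... | w , w<3 , window =
      w , w<3 , IntervalWindow-cong {w = w}
        (degree5-pattern deg≡5 xs rank-s xa₀ xa₁ pair₀ pair₁
          (λ p₀≡ps → p≢1∸p (parity<2 xs) (sym (trans (sym p₀) p₀≡ps))) (trans p₁ (sym p₀))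
          d<3 (λ block≡d → d≢block₀ (sym block≡d)) (λ block≡d → d≢block₁ (sym block≡d)))
        window

    window-for : ∀ x → DegOK (degX G x) → ∃ λ w → w < 3 × IntervalWindow (Present x) w
    window-for x (inj₁ deg≡1) = 0 , lit , degree1-window deg≡1
    window-for x (inj₂ (inj₁ deg≡2)) = 0 , lit , degree2-window deg≡2
    window-for x (inj₂ (inj₂ (inj₁ deg≡4))) = degree4-window deg≡4
    window-for x (inj₂ (inj₂ (inj₂ (inj₁ deg≡5)))) = degree5-window deg≡5
    window-for x (inj₂ (inj₂ (inj₂ (inj₂ deg≡6)))) = 0 , lit , degree6-window deg≡6

-- Only the bound Δ(G) ≤ 6 is used, not that it is attained.
lemma3p5 : (G : BipGraph) → MaxDegree G 6 → ((x : Fin (m G)) → DegOK (degX G x)) → χint≤ G 10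
lemma3p5 G (degX≤6 , degY≤6 , _) degOK =
  colouring-χint≤10 {λ x → proj₁ (window-for x (degOK x))} (λ x → proj₂ (window-for x (degOK x)))
  where open Graph.Blocks G degX≤6 degY≤6
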